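{- The $a$-Zeckendorf representation system is a place value system if and only if either $k=1$, or $k>1$ and $\Lambda=2$. When it is a place value system, its place values are $c_i=a_i$ for $i\ge0$.
   Context: Fix nonnegative integers $\lambda_1,\lambda_2,\dots$ and an integer $k\ge1$ (the order) such that $\lambda_1\ge1$, $\lambda_k\ge1$, $\lambda_i=0$ for $i>k$, and $\lambda_1\ge2$ if $k=1$. Define $(a_n)_{n\in\mathbb Z}$ by $a_n=1$ for $n\le0$ and $a_n=\sum_{i=1}^k\lambda_ia_{n-i}$ for $n\ge1$. Let $\Lambda_j=\sum_{i=1}^j\lambda_i$, $\Lambda=\Lambda_k$, and for $0\le\ell<\Lambda$ let $\mu_\ell$ be the least $j$ with $\Lambda_j>\ell$. A digit sequence $d_M,\dots,d_0$ is $a$-valid if $0\le d_i<\Lambda$ for all $i$, $d_M\ne0$, and whenever $d_i=\ell$ with $i<M$ we have $d_{i+1}=\dots=d_{i+\mu_\ell-1}=0$. Order the $a$-valid sequences so that shorter ones come first and equal-length ones are ordered lexicographically (comparing $d_M$ first); the $a$-Zeckendorf representation of a positive integer $N$ is the $N$-th sequence in this order. A digital representation system is a place value system if there is a strictly increasing integer sequence $c_0=1,c_1,c_2,\dots$ such that the number represented by $d_M,\dots,d_0$ is $\sum_{i=0}^M d_ic_i$. -}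

module Defs where

open import Data.Nat using (ℕ; zero; suc; _+_; _*_; _∸_; _<ᵇ_; _≡ᵇ_)
open import Data.Bool using (Bool; true; false; _∧_; _∨_; not; if_then_else_; T)
open import Data.List using (List; []; _∷_; length; map; concatMap; upTo; reverse; filter)
open import Relation.Binary.PropositionalEquality using (_≡_)
open import Data.Nat using (_<_)
open import Data.Product using (Σ; _×_)

sumTo : ℕ → (ℕ → ℕ) → ℕ
sumTo zero    f = 0
sumTo (suc j) f = sumTo j f + f (suc j)

-- searchFrom p j fuel : the least j' ∈ [j, j+fuel) with p j' = true
-- (returns j+fuel if there is none)
searchFrom : (ℕ → Bool) → ℕ → ℕ → ℕ
searchFrom p j zero       = j
searchFrom p j (suc fuel) = if p j then j else searchFrom p (suc j) fuel

lookupD : ℕ → List ℕ → ℕ → ℕ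
lookupD dflt []       _       = dflt
lookupD dflt (x ∷ xs) zero    = x
lookupD dflt (x ∷ xs) (suc n) = lookupD dflt xs n

countB : {A : Set} → (A → Bool) → List A → ℕ
countB p []       = 0
countB p (x ∷ xs) = (if p x then 1 else 0) + countB p xs

-- Everything is parametrised by the coefficients lam (lam i = λ_i, i ≥ 1;
-- lam 0 is never used) and the order k.
module Zeck (lam : ℕ → ℕ) (k : ℕ) where

  aHist : ℕ → List ℕ
  aHist zero    = 1 ∷ []
  aHist (suc n) = sumTo k (λ i → lam i * lookupD 1 (aHist n) (i ∸ 1)) ∷ aHist n
    -- a_{n+1} = Σ_{i=1}^k λ_i a_{n+1-i}, where a_m = 1 for m ≤ 0
    -- (index i ∸ 1 in aHist n is a_{n+1-i}; out of range means m ≤ 0 ↦ 1)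

  a : ℕ → ℕ
  a n = lookupD 1 (aHist n) 0

  Λj : ℕ → ℕ
  Λj j = sumTo j lam

  Λ : ℕ
  Λ = Λj k

  -- μ_ℓ = least j with Λ_j > ℓ (searched in 0..k; Λ_0 = 0 so j ≥ 1)
  μ : ℕ → ℕ
  μ ℓ = searchFrom (λ j → ℓ <ᵇ Λj j) 0 (suc k)

  -- digit sequences are lists written most significant digit first:
  --   d_M ∷ d_{M-1} ∷ … ∷ d_0 ∷ []

  zerosFirst : ℕ → List ℕ → Bool
  zerosFirst zero    _        = true
  zerosFirst (suc n) []       = true
  zerosFirst (suc n) (x ∷ xs) = (x ≡ᵇ 0) ∧ zerosFirst n xs

  -- on the little-endian list d_0 ∷ d_1 ∷ … ∷ d_M :
  -- for every i < M with d_i = ℓ, d_{i+1} = … = d_{i+μ_ℓ-1} = 0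
  blockCond : List ℕ → Bool
  blockCond []                 = true
  blockCond (d ∷ [])           = true
  blockCond (d ∷ rest@(_ ∷ _)) = zerosFirst (μ d ∸ 1) rest ∧ blockCond rest

  allLtΛ : List ℕ → Bool
  allLtΛ []       = true
  allLtΛ (x ∷ xs) = (x <ᵇ Λ) ∧ allLtΛ xs

  valid : List ℕ → Bool
  valid []       = false
  valid (d ∷ ds) = not (d ≡ᵇ 0) ∧ allLtΛ (d ∷ ds) ∧ blockCond (reverse (d ∷ ds))

  Valid : List ℕ → Set
  Valid ds = T (valid ds)

  lexLt : List ℕ → List ℕ → Bool
  lexLt []       _        = false
  lexLt (_ ∷ _)  []       = false
  lexLt (x ∷ xs) (y ∷ ys) = (x <ᵇ y) ∨ ((x ≡ᵇ y) ∧ lexLt xs ys)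

  precedes : List ℕ → List ℕ → Bool
  precedes e d = (length e <ᵇ length d) ∨ ((length e ≡ᵇ length d) ∧ lexLt e d)

  words : ℕ → List (List ℕ)
  words zero    = [] ∷ []
  words (suc L) = concatMap (λ x → map (x ∷_) (words L)) (upTo Λ)

  wordsUpTo : ℕ → List (List ℕ)
  wordsUpTo L = concatMap words (upTo (suc L))

  -- position (1-based) of a valid sequence d in the order:
  -- 1 + #{valid e : e precedes d}.  Hence d is the a-Zeckendorf
  -- representation of N iff rank d ≡ N, i.e. rank d is the number d represents.
  rank : List ℕ → ℕ
  rank d = suc (countB (λ e → valid e ∧ precedes e d) (wordsUpTo (length d)))

  value : (ℕ → ℕ) → List ℕ → ℕ
  value c []       = 0
  value c (d ∷ ds) = d * c (length ds) + value c ds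

  IsPlaceValues : (ℕ → ℕ) → Set
  IsPlaceValues c =
    (c 0 ≡ 1) × (∀ i → c i < c (suc i)) × (∀ ds → Valid ds → value c ds ≡ rank ds)

  IsPlaceValueSystem : Set
  IsPlaceValueSystem = Σ (ℕ → ℕ) IsPlaceValues

-- Call a digit string admissible if it is a-valid except that leading zeros are allowed.
-- Since the digit 0 makes no demand (μ 0 = 1), the rank of a valid string d of length n + 1
-- is the number of admissible strings of length n + 1 lexicographically below d; in particular
-- the rank of 1 0ⁿ is #adm n, the number of admissible strings of length n, so place values,
-- if they exist, must be cᵢ = #adm i. For k = 1 every string of digits below Λ is admissible,
-- and for Λ = 2 the only digits are 0 and 1, a 1 demanding k - 1 zeros above it; in both cases
-- counting the smaller strings digit by digit yields Σ dᵢ · #adm i, and #adm satisfies the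
-- recurrence of a. For k ≥ 2 and Λ ≥ 3 the string 1 λ₁ is not admissible although λ₁ is
-- (μ λ₁ ≥ 2), so fewer than #adm 1 admissible strings of length 2 begin with 1, and the rank
-- of 2 0 is less than twice the rank #adm 1 of 1 0.
module Submission where

open import Data.Bool using (Bool; true; false; _∧_; _∨_; not; if_then_else_; T)
open import Data.Bool.Properties using (∧-assoc; ∧-comm; ∧-identityʳ; ∧-zeroʳ; ∨-zeroʳ; ∧-conicalˡ; ∧-conicalʳ; T-≡)
open import Data.Empty using (⊥-elim)
open import Data.List using (List; []; _∷_; _++_; [_]; length; map; concatMap; upTo; reverse; replicate)
open import Data.List.Properties using (map-++; map-cong; upTo-∷ʳ; unfold-reverse; length-++; length-replicate)
open import Data.Nat using (>-nonZero; ℕ; zero; suc; _+_; _*_; _∸_; _<ᵇ_; _≤ᵇ_; _≡ᵇ_; _≤_; _<_; z≤n; s≤s)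
open import Data.Nat.ListAction using (sum)
open import Data.Nat.ListAction.Properties using (sum-++)
open import Data.Nat.Properties
open import Data.Product using (_×_; _,_)
open import Data.Sum using (_⊎_; inj₁; inj₂)
open import Function.Base using (_∘_; const)
open import Function.Bundles using (_⇔_; mk⇔; Equivalence)
open import Relation.Binary.PropositionalEquality
  using (_≡_; _≢_; refl; sym; trans; cong; cong₂; subst; subst₂; module ≡-Reasoning)
open import Relation.Nullary using (¬_; yes; no)

open import Defs

T⇒≡true : ∀ {b} → T b → b ≡ true
T⇒≡true = Equivalence.to T-≡

≡true⇒T : ∀ {b} → b ≡ true → T b
≡true⇒T = Equivalence.from T-≡

<⇒<ᵇ≡true : ∀ {m n} → m < n → (m <ᵇ n) ≡ true
<⇒<ᵇ≡true = T⇒≡true ∘ <⇒<ᵇ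

≤⇒<ᵇ≡false : ∀ {m n} → n ≤ m → (m <ᵇ n) ≡ false
≤⇒<ᵇ≡false {m} {zero}  _         = refl
≤⇒<ᵇ≡false {suc m} {suc n} (s≤s n≤m) = ≤⇒<ᵇ≡false n≤m

≤⇒≤ᵇ≡true : ∀ {m n} → m ≤ n → (m ≤ᵇ n) ≡ true
≤⇒≤ᵇ≡true = T⇒≡true ∘ ≤⇒≤ᵇ

<⇒≤ᵇ≡false : ∀ {m n} → n < m → (m ≤ᵇ n) ≡ false
<⇒≤ᵇ≡false {suc m} n<m = ≤⇒<ᵇ≡false (≤-pred n<m)

≡ᵇ-refl : ∀ n → (n ≡ᵇ n) ≡ true
≡ᵇ-refl n = T⇒≡true (≡⇒≡ᵇ n n refl)

≢⇒≡ᵇ≡false : ∀ {m n} → m ≢ n → (m ≡ᵇ n) ≡ false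
≢⇒≡ᵇ≡false {zero}  {zero}  m≢n = ⊥-elim (m≢n refl)
≢⇒≡ᵇ≡false {zero}  {suc n} _   = refl
≢⇒≡ᵇ≡false {suc m} {zero}  _   = refl
≢⇒≡ᵇ≡false {suc m} {suc n} m≢n = ≢⇒≡ᵇ≡false (m≢n ∘ cong suc)

sum-map-upTo-suc : ∀ (h : ℕ → ℕ) n → sum (map h (upTo (suc n))) ≡ sum (map h (upTo n)) + h n
sum-map-upTo-suc h n = begin
  sum (map h (upTo (suc n)))        ≡⟨ cong (sum ∘ map h) (upTo-∷ʳ n) ⟨
  sum (map h (upTo n ++ [ n ]))     ≡⟨ cong sum (map-++ h (upTo n) [ n ]) ⟩
  sum (map h (upTo n) ++ [ h n ])   ≡⟨ sum-++ (map h (upTo n)) [ h n ] ⟩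
  sum (map h (upTo n)) + (h n + 0)  ≡⟨ cong (sum (map h (upTo n)) +_) (+-identityʳ (h n)) ⟩
  sum (map h (upTo n)) + h n        ∎
  where open ≡-Reasoning

sum-map-upTo-cong : ∀ {h h′ : ℕ → ℕ} n → (∀ x → x < n → h x ≡ h′ x) →
                    sum (map h (upTo n)) ≡ sum (map h′ (upTo n))
sum-map-upTo-cong zero _ = refl
sum-map-upTo-cong {h} {h′} (suc n) h≗h′ = begin
  sum (map h (upTo (suc n)))   ≡⟨ sum-map-upTo-suc h n ⟩
  sum (map h (upTo n)) + h n   ≡⟨ cong₂ _+_ (sum-map-upTo-cong n (λ x x<n → h≗h′ x (m<n⇒m<1+n x<n))) (h≗h′ n ≤-refl) ⟩
  sum (map h′ (upTo n)) + h′ n ≡⟨ sum-map-upTo-suc h′ n ⟨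
  sum (map h′ (upTo (suc n)))  ∎
  where open ≡-Reasoning

sum-map-upTo-truncate : ∀ {h : ℕ → ℕ} {m} n → m ≤ n → (∀ x → m ≤ x → h x ≡ 0) →
                        sum (map h (upTo n)) ≡ sum (map h (upTo m))
sum-map-upTo-truncate zero z≤n _ = refl
sum-map-upTo-truncate {h} (suc n) m≤1+n vanish with m≤n⇒m<n∨m≡n m≤1+n
... | inj₂ refl   = refl
... | inj₁ m<1+n  = trans (sum-map-upTo-suc h n)
  (trans (cong₂ _+_ (sum-map-upTo-truncate n (≤-pred m<1+n) vanish) (vanish n (≤-pred m<1+n))) (+-identityʳ _))

sum-map-upTo-const : ∀ c n → sum (map (const c) (upTo n)) ≡ n * c
sum-map-upTo-const c zero    = refl
sum-map-upTo-const c (suc n) = trans (sum-map-upTo-suc (const c) n)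
  (trans (cong (_+ c) (sum-map-upTo-const c n)) (+-comm (n * c) c))

sum-map-mono : ∀ {h h′ : ℕ → ℕ} → (∀ x → h x ≤ h′ x) → ∀ xs → sum (map h xs) ≤ sum (map h′ xs)
sum-map-mono h≤h′ []       = z≤n
sum-map-mono h≤h′ (x ∷ xs) = +-mono-≤ (h≤h′ x) (sum-map-mono h≤h′ xs)

sum-map-upTo-strict : ∀ {h h′ : ℕ → ℕ} → (∀ x → h x ≤ h′ x) → ∀ {x} n → x < n → h x < h′ x →
                      sum (map h (upTo n)) < sum (map h′ (upTo n))
sum-map-upTo-strict {h} {h′} h≤h′ {x} (suc n) x<1+n hx<h′x = subst₂ _<_
  (sym (sum-map-upTo-suc h n)) (sym (sum-map-upTo-suc h′ n)) (last (m≤n⇒m<n∨m≡n (≤-pred x<1+n)))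
  where
  last : x < n ⊎ x ≡ n → sum (map h (upTo n)) + h n < sum (map h′ (upTo n)) + h′ n
  last (inj₁ x<n)  = +-mono-<-≤ (sum-map-upTo-strict h≤h′ n x<n hx<h′x) (h≤h′ n)
  last (inj₂ refl) = +-mono-≤-< (sum-map-mono h≤h′ (upTo n)) hx<h′x

module _ {A : Set} where

  countB-++ : ∀ (p : A → Bool) xs ys → countB p (xs ++ ys) ≡ countB p xs + countB p ys
  countB-++ p []       ys = refl
  countB-++ p (x ∷ xs) ys = trans (cong (_ +_) (countB-++ p xs ys)) (sym (+-assoc (if p x then 1 else 0) (countB p xs) (countB p ys)))

  countB-cong : ∀ {p q : A → Bool} → (∀ x → p x ≡ q x) → ∀ xs → countB p xs ≡ countB q xs
  countB-cong p≗q []       = refl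
  countB-cong p≗q (x ∷ xs) = cong₂ (λ b n → (if b then 1 else 0) + n) (p≗q x) (countB-cong p≗q xs)

  countB-false : ∀ xs → countB {A} (const false) xs ≡ 0
  countB-false []       = refl
  countB-false (x ∷ xs) = countB-false xs

  countB-mono : ∀ {p q : A → Bool} → (∀ x → p x ≡ true → q x ≡ true) → ∀ xs → countB p xs ≤ countB q xs
  countB-mono p⇒q [] = z≤n
  countB-mono {p} {q} p⇒q (x ∷ xs) with p x in px | q x in qx
  ... | true  | true  = s≤s (countB-mono p⇒q xs)
  ... | true  | false with () ← trans (sym (p⇒q x px)) qx
  ... | false | true  = m≤n⇒m≤1+n (countB-mono p⇒q xs)
  ... | false | false = countB-mono p⇒q xs

  countB-partition : ∀ (q p : A → Bool) xs →
                     countB p xs ≡ countB (λ x → q x ∧ p x) xs + countB (λ x → not (q x) ∧ p x) xs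
  countB-partition q p [] = refl
  countB-partition q p (x ∷ xs) with q x | p x
  ... | true  | true  = cong suc (countB-partition q p xs)
  ... | false | true  = trans (cong suc (countB-partition q p xs)) (sym (+-suc _ _))
  ... | true  | false = countB-partition q p xs
  ... | false | false = countB-partition q p xs

countB-map : ∀ {A B : Set} (p : B → Bool) (f : A → B) xs → countB p (map f xs) ≡ countB (p ∘ f) xs
countB-map p f []       = refl
countB-map p f (x ∷ xs) = cong (_ +_) (countB-map p f xs)

countB-concatMap : ∀ {A : Set} (p : A → Bool) (g : ℕ → List A) xs →
                   countB p (concatMap g xs) ≡ sum (map (countB p ∘ g) xs)
countB-concatMap p g []       = refl
countB-concatMap p g (x ∷ xs) = trans (countB-++ p (g x) (concatMap g xs)) (cong (_ +_) (countB-concatMap p g xs))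

∧∨-shuffle : ∀ a b c x w → (a ∧ (b ∨ x)) ∧ (c ∧ (x ∨ w)) ≡ (a ∧ c) ∧ (x ∨ (b ∧ w))
∧∨-shuffle false _     _ _     _ = refl
∧∨-shuffle true  true  _ _     _ = refl
∧∨-shuffle true  false _ true  _ = refl
∧∨-shuffle true  false c false _ = sym (∧-zeroʳ c)

∧-implied : ∀ {a b} → (a ≡ true → b ≡ true) → a ∧ b ≡ a
∧-implied {false} _   = refl
∧-implied {true}  a⇒b = a⇒b refl

≤ᵇ≡<ᵇ-suc : ∀ m n → (m ≤ᵇ n) ≡ (m <ᵇ suc n)
≤ᵇ≡<ᵇ-suc zero    n = refl
≤ᵇ≡<ᵇ-suc (suc m) n = refl

searchFrom-≤ : ∀ p {r} j fuel → p r ≡ true → j ≤ r → r < j + fuel → searchFrom p j fuel ≤ r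
searchFrom-≤ p {r} j zero _ j≤r r<j+0 = ⊥-elim (<-irrefl refl (≤-<-trans j≤r (subst (r <_) (+-identityʳ j) r<j+0)))
searchFrom-≤ p {r} j (suc fuel) pr j≤r r<j+1+fuel with p j in pj
... | true  = j≤r
... | false with m≤n⇒m<n∨m≡n j≤r
...   | inj₁ j<r  = searchFrom-≤ p (suc j) fuel pr j<r (subst (r <_) (+-suc j fuel) r<j+1+fuel)
...   | inj₂ refl with () ← trans (sym pj) pr

≤-searchFrom : ∀ p j fuel → j ≤ searchFrom p j fuel
≤-searchFrom p j zero       = ≤-refl
≤-searchFrom p j (suc fuel) with p j
... | true  = ≤-refl
... | false = <⇒≤ (≤-searchFrom p (suc j) fuel)

searchFrom-≥ : ∀ p {r} j fuel → (∀ i → j ≤ i → i < r → p i ≡ false) → r ≤ j + fuel → r ≤ searchFrom p j fuel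
searchFrom-≥ p j zero _ r≤j+0 = subst (_ ≤_) (+-identityʳ j) r≤j+0
searchFrom-≥ p {r} j (suc fuel) misses r≤j+1+fuel with j <? r
... | no j≮r = ≤-trans (≮⇒≥ j≮r) (≤-searchFrom p j (suc fuel))
... | yes j<r rewrite misses j ≤-refl j<r =
  searchFrom-≥ p (suc j) fuel (λ i 1+j≤i → misses i (<⇒≤ 1+j≤i)) (subst (r ≤_) (+-suc j fuel) r≤j+1+fuel)

sumTo-mono : ∀ f {i j} → i ≤ j → sumTo i f ≤ sumTo j f
sumTo-mono f {j = zero}  z≤n = ≤-refl
sumTo-mono f {i} {suc j} i≤1+j with m≤n⇒m<n∨m≡n i≤1+j
... | inj₁ i<1+j = ≤-trans (sumTo-mono f (≤-pred i<1+j)) (m≤m+n (sumTo j f) (f (suc j)))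
... | inj₂ refl  = ≤-refl

leadingNonzero : List ℕ → Bool
leadingNonzero []      = false
leadingNonzero (d ∷ _) = not (d ≡ᵇ 0)

zeros : ℕ → List ℕ
zeros n = replicate n 0

module Admissibility (lam : ℕ → ℕ) (k : ℕ) where
  open Zeck lam k public

  admissible : List ℕ → Bool
  admissible ds = allLtΛ ds ∧ blockCond (reverse ds)

  valid≡leadingNonzero∧admissible : ∀ ds → valid ds ≡ leadingNonzero ds ∧ admissible ds
  valid≡leadingNonzero∧admissible []      = refl
  valid≡leadingNonzero∧admissible (_ ∷ _) = refl

  Valid⇒admissible : ∀ d → Valid d → admissible d ≡ true
  Valid⇒admissible d v =
    ∧-conicalʳ (leadingNonzero d) _ (trans (sym (valid≡leadingNonzero∧admissible d)) (T⇒≡true v))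

  #adm : ℕ → ℕ
  #adm n = countB admissible (words n)

  countBelow : List ℕ → ℕ
  countBelow e = countB (λ f → admissible f ∧ lexLt f e) (words (length e))

  lexLt-zeros : ∀ f n → lexLt f (zeros n) ≡ false
  lexLt-zeros []      _       = refl
  lexLt-zeros (_ ∷ _) zero    = refl
  lexLt-zeros (x ∷ f) (suc n) = trans (cong ((x ≡ᵇ 0) ∧_) (lexLt-zeros f n)) (∧-zeroʳ (x ≡ᵇ 0))

  -- fits o ds: the i-th digit ℓ of ds, counted from the most significant one, has μ ℓ - 1 ≤ o + i,
  -- i.e. the zeros it demands above itself lie inside ds or in o further places to its left.
  fits : ℕ → List ℕ → Bool
  fits o []       = true
  fits o (d ∷ ds) = (μ d ∸ 1 ≤ᵇ o) ∧ fits (suc o) ds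

  fitsᴿ : ℕ → List ℕ → Bool
  fitsᴿ o []       = true
  fitsᴿ o (d ∷ ds) = (μ d ∸ 1 ≤ᵇ length ds + o) ∧ fitsᴿ o ds

  fitsᴿ-∷ʳ : ∀ o l y → fitsᴿ o (l ++ [ y ]) ≡ fitsᴿ (suc o) l ∧ (μ y ∸ 1 ≤ᵇ o)
  fitsᴿ-∷ʳ o []      y = ∧-identityʳ _
  fitsᴿ-∷ʳ o (d ∷ l) y = begin
    (μ d ∸ 1 ≤ᵇ length (l ++ [ y ]) + o) ∧ fitsᴿ o (l ++ [ y ])
      ≡⟨ cong₂ (λ n b → (μ d ∸ 1 ≤ᵇ n) ∧ b) length-shift (fitsᴿ-∷ʳ o l y) ⟩
    (μ d ∸ 1 ≤ᵇ length l + suc o) ∧ (fitsᴿ (suc o) l ∧ (μ y ∸ 1 ≤ᵇ o))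
      ≡⟨ ∧-assoc (μ d ∸ 1 ≤ᵇ length l + suc o) _ _ ⟨
    fitsᴿ (suc o) (d ∷ l) ∧ (μ y ∸ 1 ≤ᵇ o) ∎
    where
    open ≡-Reasoning
    length-shift : length (l ++ [ y ]) + o ≡ length l + suc o
    length-shift = trans (cong (_+ o) (trans (length-++ l) (+-comm (length l) 1))) (sym (+-suc (length l) o))

  fitsᴿ-reverse : ∀ o f → fitsᴿ o (reverse f) ≡ fits o f
  fitsᴿ-reverse o []      = refl
  fitsᴿ-reverse o (y ∷ f) = begin
    fitsᴿ o (reverse (y ∷ f))                ≡⟨ cong (fitsᴿ o) (unfold-reverse y f) ⟩
    fitsᴿ o (reverse f ++ [ y ])             ≡⟨ fitsᴿ-∷ʳ o (reverse f) y ⟩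
    fitsᴿ (suc o) (reverse f) ∧ (μ y ∸ 1 ≤ᵇ o) ≡⟨ cong (_∧ (μ y ∸ 1 ≤ᵇ o)) (fitsᴿ-reverse (suc o) f) ⟩
    fits (suc o) f ∧ (μ y ∸ 1 ≤ᵇ o)          ≡⟨ ∧-comm (fits (suc o) f) _ ⟩
    fits o (y ∷ f)                           ∎
    where open ≡-Reasoning

  zerosFirst-[] : ∀ n → zerosFirst n [] ≡ true
  zerosFirst-[] zero    = refl
  zerosFirst-[] (suc n) = refl

  zerosFirst-∷ʳ : ∀ n ys x → zerosFirst n (ys ++ [ x ]) ≡ zerosFirst n ys ∧ ((n ≤ᵇ length ys) ∨ (x ≡ᵇ 0))
  zerosFirst-∷ʳ zero    ys       x = refl
  zerosFirst-∷ʳ (suc n) []       x = trans (cong ((x ≡ᵇ 0) ∧_) (zerosFirst-[] n)) (∧-identityʳ (x ≡ᵇ 0))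
  zerosFirst-∷ʳ (suc n) (y ∷ ys) x = begin
    (y ≡ᵇ 0) ∧ zerosFirst n (ys ++ [ x ])
      ≡⟨ cong ((y ≡ᵇ 0) ∧_) (zerosFirst-∷ʳ n ys x) ⟩
    (y ≡ᵇ 0) ∧ (zerosFirst n ys ∧ ((n ≤ᵇ length ys) ∨ (x ≡ᵇ 0)))
      ≡⟨ ∧-assoc (y ≡ᵇ 0) _ _ ⟨
    zerosFirst (suc n) (y ∷ ys) ∧ ((n ≤ᵇ length ys) ∨ (x ≡ᵇ 0))
      ≡⟨ cong (λ b → zerosFirst (suc n) (y ∷ ys) ∧ (b ∨ (x ≡ᵇ 0))) (≤ᵇ≡<ᵇ-suc n (length ys)) ⟩
    zerosFirst (suc n) (y ∷ ys) ∧ ((suc n ≤ᵇ length (y ∷ ys)) ∨ (x ≡ᵇ 0)) ∎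
    where open ≡-Reasoning

  blockCond-∷ : ∀ d r → blockCond (d ∷ r) ≡ zerosFirst (μ d ∸ 1) r ∧ blockCond r
  blockCond-∷ d []      = sym (cong (_∧ true) (zerosFirst-[] (μ d ∸ 1)))
  blockCond-∷ d (_ ∷ _) = refl

  blockCond-∷ʳ : ∀ l x → blockCond (l ++ [ x ]) ≡ blockCond l ∧ ((x ≡ᵇ 0) ∨ fitsᴿ 0 l)
  blockCond-∷ʳ []      x = sym (∨-zeroʳ (x ≡ᵇ 0))
  blockCond-∷ʳ (d ∷ l) x = begin
    blockCond (d ∷ (l ++ [ x ]))
      ≡⟨ blockCond-∷ d (l ++ [ x ]) ⟩
    zerosFirst m (l ++ [ x ]) ∧ blockCond (l ++ [ x ])
      ≡⟨ cong₂ _∧_ (zerosFirst-∷ʳ m l x) (blockCond-∷ʳ l x) ⟩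
    (zerosFirst m l ∧ ((m ≤ᵇ length l) ∨ (x ≡ᵇ 0))) ∧ (blockCond l ∧ ((x ≡ᵇ 0) ∨ fitsᴿ 0 l))
      ≡⟨ ∧∨-shuffle (zerosFirst m l) (m ≤ᵇ length l) (blockCond l) (x ≡ᵇ 0) (fitsᴿ 0 l) ⟩
    (zerosFirst m l ∧ blockCond l) ∧ ((x ≡ᵇ 0) ∨ ((m ≤ᵇ length l) ∧ fitsᴿ 0 l))
      ≡⟨ cong₂ (λ b n → b ∧ ((x ≡ᵇ 0) ∨ ((m ≤ᵇ n) ∧ fitsᴿ 0 l))) (blockCond-∷ d l) (+-identityʳ (length l)) ⟨
    blockCond (d ∷ l) ∧ ((x ≡ᵇ 0) ∨ fitsᴿ 0 (d ∷ l)) ∎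
    where
    open ≡-Reasoning
    m = μ d ∸ 1

  admissible-∷ : ∀ x f → admissible (x ∷ f) ≡ (x <ᵇ Λ) ∧ (admissible f ∧ ((x ≡ᵇ 0) ∨ fits 0 f))
  admissible-∷ x f = begin
    ((x <ᵇ Λ) ∧ allLtΛ f) ∧ blockCond (reverse (x ∷ f))
      ≡⟨ cong (λ l → ((x <ᵇ Λ) ∧ allLtΛ f) ∧ blockCond l) (unfold-reverse x f) ⟩
    ((x <ᵇ Λ) ∧ allLtΛ f) ∧ blockCond (reverse f ++ [ x ])
      ≡⟨ cong (((x <ᵇ Λ) ∧ allLtΛ f) ∧_) (blockCond-∷ʳ (reverse f) x) ⟩
    ((x <ᵇ Λ) ∧ allLtΛ f) ∧ (blockCond (reverse f) ∧ ((x ≡ᵇ 0) ∨ fitsᴿ 0 (reverse f)))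
      ≡⟨ cong (λ b → ((x <ᵇ Λ) ∧ allLtΛ f) ∧ (blockCond (reverse f) ∧ ((x ≡ᵇ 0) ∨ b))) (fitsᴿ-reverse 0 f) ⟩
    ((x <ᵇ Λ) ∧ allLtΛ f) ∧ (blockCond (reverse f) ∧ ((x ≡ᵇ 0) ∨ fits 0 f))
      ≡⟨ ∧-assoc (x <ᵇ Λ) _ _ ⟩
    (x <ᵇ Λ) ∧ (allLtΛ f ∧ (blockCond (reverse f) ∧ ((x ≡ᵇ 0) ∨ fits 0 f)))
      ≡⟨ cong ((x <ᵇ Λ) ∧_) (∧-assoc (allLtΛ f) _ _) ⟨
    (x <ᵇ Λ) ∧ (admissible f ∧ ((x ≡ᵇ 0) ∨ fits 0 f)) ∎
    where open ≡-Reasoning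

  admissible-∷⇒admissible : ∀ x f → admissible (x ∷ f) ≡ true → admissible f ≡ true
  admissible-∷⇒admissible x f adm = ∧-conicalˡ (admissible f) _ (∧-conicalʳ (x <ᵇ Λ) _ (trans (sym (admissible-∷ x f)) adm))

  countB-words-suc : ∀ p n → countB p (words (suc n)) ≡ sum (map (λ x → countB (p ∘ (x ∷_)) (words n)) (upTo Λ))
  countB-words-suc p n = trans (countB-concatMap p (λ x → map (x ∷_) (words n)) (upTo Λ))
    (cong sum (map-cong (λ x → countB-map p (x ∷_) (words n)) (upTo Λ)))

  countB-words-cong : ∀ {p q} n → (∀ e → length e ≡ n → p e ≡ q e) → countB p (words n) ≡ countB q (words n)
  countB-words-cong zero    p≗q = cong (λ b → (if b then 1 else 0) + 0) (p≗q [] refl)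
  countB-words-cong {p} {q} (suc n) p≗q = begin
    countB p (words (suc n))                                       ≡⟨ countB-words-suc p n ⟩
    sum (map (λ x → countB (p ∘ (x ∷_)) (words n)) (upTo Λ))
      ≡⟨ cong sum (map-cong (λ x → countB-words-cong n (λ e e≡n → p≗q (x ∷ e) (cong suc e≡n))) (upTo Λ)) ⟩
    sum (map (λ x → countB (q ∘ (x ∷_)) (words n)) (upTo Λ))       ≡⟨ countB-words-suc q n ⟨
    countB q (words (suc n))                                       ∎
    where open ≡-Reasoning

  lexLt-∷-< : ∀ {x y} f e → x < y → lexLt (x ∷ f) (y ∷ e) ≡ true
  lexLt-∷-< {x} {y} f e x<y = cong (_∨ ((x ≡ᵇ y) ∧ lexLt f e)) (<⇒<ᵇ≡true x<y)

  lexLt-∷-≡ : ∀ y f e → lexLt (y ∷ f) (y ∷ e) ≡ lexLt f e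
  lexLt-∷-≡ y f e = cong₂ (λ b c → b ∨ (c ∧ lexLt f e)) (≤⇒<ᵇ≡false (≤-refl {y})) (≡ᵇ-refl y)

  lexLt-∷-> : ∀ {x y} f e → y < x → lexLt (x ∷ f) (y ∷ e) ≡ false
  lexLt-∷-> f e y<x = cong₂ (λ b c → b ∨ (c ∧ lexLt f e)) (≤⇒<ᵇ≡false (<⇒≤ y<x)) (≢⇒≡ᵇ≡false (>⇒≢ y<x))

  countB-lexLt-∷ : ∀ (P : List ℕ → Bool) y e n → y < Λ →
    countB (λ f → P f ∧ lexLt f (y ∷ e)) (words (suc n))
      ≡ sum (map (λ x → countB (P ∘ (x ∷_)) (words n)) (upTo y)) + countB (λ f → P (y ∷ f) ∧ lexLt f e) (words n)
  countB-lexLt-∷ P y e n y<Λ = begin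
    countB (λ f → P f ∧ lexLt f (y ∷ e)) (words (suc n))   ≡⟨ countB-words-suc _ n ⟩
    sum (map h (upTo Λ))                                  ≡⟨ sum-map-upTo-truncate Λ y<Λ above ⟩
    sum (map h (upTo (suc y)))                            ≡⟨ sum-map-upTo-suc h y ⟩
    sum (map h (upTo y)) + h y                            ≡⟨ cong₂ _+_ (sum-map-upTo-cong y below) at ⟩
    sum (map (λ x → countB (P ∘ (x ∷_)) (words n)) (upTo y)) + countB (λ f → P (y ∷ f) ∧ lexLt f e) (words n) ∎
    where
    open ≡-Reasoning
    h : ℕ → ℕ
    h x = countB (λ f → P (x ∷ f) ∧ lexLt (x ∷ f) (y ∷ e)) (words n)
    below : ∀ x → x < y → h x ≡ countB (P ∘ (x ∷_)) (words n)
    below x x<y = countB-cong (λ f → trans (cong (P (x ∷ f) ∧_) (lexLt-∷-< f e x<y)) (∧-identityʳ _)) (words n)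
    at : h y ≡ countB (λ f → P (y ∷ f) ∧ lexLt f e) (words n)
    at = countB-cong (λ f → cong (P (y ∷ f) ∧_) (lexLt-∷-≡ y f e)) (words n)
    above : ∀ x → suc y ≤ x → h x ≡ 0
    above x y<x = trans (countB-cong (λ f → trans (cong (P (x ∷ f) ∧_) (lexLt-∷-> f e y<x)) (∧-zeroʳ _)) (words n))
                        (countB-false (words n))

  μ-≤ : ∀ {ℓ r} → r ≤ k → ℓ < Λj r → μ ℓ ≤ r
  μ-≤ {ℓ} r≤k ℓ<Λjr = searchFrom-≤ (λ j → ℓ <ᵇ Λj j) 0 (suc k) (<⇒<ᵇ≡true ℓ<Λjr) z≤n (s≤s r≤k)

  μ-≥ : ∀ {ℓ r} → r ≤ suc k → (∀ i → i < r → Λj i ≤ ℓ) → r ≤ μ ℓ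
  μ-≥ {ℓ} r≤1+k Λj<ℓ = searchFrom-≥ (λ j → ℓ <ᵇ Λj j) 0 (suc k) (λ i _ i<r → ≤⇒<ᵇ≡false (Λj<ℓ i i<r)) r≤1+k

  fits-mono : ∀ {o o′} f → o ≤ o′ → fits o f ≡ true → fits o′ f ≡ true
  fits-mono []      _    _        = refl
  fits-mono {o} {o′} (y ∷ f) o≤o′ fits-y∷f = cong₂ _∧_
    (≤⇒≤ᵇ≡true (≤-trans (≤ᵇ⇒≤ (μ y ∸ 1) o (≡true⇒T (∧-conicalˡ _ _ fits-y∷f))) o≤o′))
    (fits-mono f (s≤s o≤o′) (∧-conicalʳ (μ y ∸ 1 ≤ᵇ o) _ fits-y∷f))

  #valid : ℕ → ℕ
  #valid n = countB valid (words n)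

  value-cong : ∀ {c c′} → (∀ i → c i ≡ c′ i) → ∀ ds → value c ds ≡ value c′ ds
  value-cong c≗c′ []       = refl
  value-cong c≗c′ (d ∷ ds) = cong₂ _+_ (cong (d *_) (c≗c′ (length ds))) (value-cong c≗c′ ds)

  IsPlaceValues-cong : ∀ {c c′} → (∀ i → c i ≡ c′ i) → IsPlaceValues c → IsPlaceValues c′
  IsPlaceValues-cong {c} {c′} c≗c′ (c0≡1 , c-increasing , value≡rank) =
      trans (sym (c≗c′ 0)) c0≡1
    , (λ i → subst₂ _<_ (c≗c′ i) (c≗c′ (suc i)) (c-increasing i))
    , (λ ds v → trans (sym (value-cong c≗c′ ds)) (value≡rank ds v))

  module Nondegenerate (1≤k : 1 ≤ k) (1≤lam1 : 1 ≤ lam 1) where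

    lam1≤Λ : lam 1 ≤ Λ
    lam1≤Λ = sumTo-mono lam 1≤k

    μ0≡1 : μ 0 ≡ 1
    μ0≡1 = ≤-antisym (μ-≤ 1≤k 1≤lam1) (μ-≥ (s≤s z≤n) (λ { zero _ → z≤n ; (suc _) (s≤s ()) }))

    fits-0∷ : ∀ o f → fits o (0 ∷ f) ≡ fits (suc o) f
    fits-0∷ o f rewrite μ0≡1 = refl

    fits-zeros : ∀ o n → fits o (zeros n) ≡ true
    fits-zeros o zero    = refl
    fits-zeros o (suc n) = trans (fits-0∷ o (zeros n)) (fits-zeros (suc o) n)

    admissible-0∷ : ∀ f → admissible (0 ∷ f) ≡ admissible f
    admissible-0∷ f = trans (admissible-∷ 0 f)
      (trans (cong (_∧ (admissible f ∧ true)) (<⇒<ᵇ≡true (≤-trans 1≤lam1 lam1≤Λ))) (∧-identityʳ (admissible f)))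

    admissible-zeros : ∀ n → admissible (zeros n) ≡ true
    admissible-zeros zero    = refl
    admissible-zeros (suc n) = trans (admissible-0∷ (zeros n)) (admissible-zeros n)

    countB-words-suc-leading : ∀ p m → countB p (words (suc m))
      ≡ countB (p ∘ (0 ∷_)) (words m) + countB (λ e → leadingNonzero e ∧ p e) (words (suc m))
    countB-words-suc-leading p m = begin
      countB p (words (suc m))                           ≡⟨ countB-partition leadingNonzero p (words (suc m)) ⟩
      nonzeroFirst + zeroFirst                           ≡⟨ +-comm nonzeroFirst zeroFirst ⟩
      zeroFirst + nonzeroFirst                           ≡⟨ cong (_+ nonzeroFirst) zeroFirst≡ ⟩
      countB (p ∘ (0 ∷_)) (words m) + nonzeroFirst       ∎
      where
      open ≡-Reasoning
      nonzeroFirst zeroFirst : ℕ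
      nonzeroFirst = countB (λ e → leadingNonzero e ∧ p e) (words (suc m))
      zeroFirst    = countB (λ e → not (leadingNonzero e) ∧ p e) (words (suc m))
      h : ℕ → ℕ
      h x = countB (λ f → not (not (x ≡ᵇ 0)) ∧ p (x ∷ f)) (words m)
      zeroFirst≡ : zeroFirst ≡ countB (p ∘ (0 ∷_)) (words m)
      zeroFirst≡ = trans (countB-words-suc (λ e → not (leadingNonzero e) ∧ p e) m)
        (trans (sum-map-upTo-truncate {h} Λ (≤-trans 1≤lam1 lam1≤Λ) (λ { (suc x) _ → countB-false (words m) }))
               (+-identityʳ _))

    #adm≡1+∑#valid : ∀ m → #adm m ≡ suc (sum (map #valid (upTo (suc m))))
    #adm≡1+∑#valid zero    = refl
    #adm≡1+∑#valid (suc m) = begin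
      #adm (suc m)
        ≡⟨ countB-words-suc-leading admissible m ⟩
      countB (admissible ∘ (0 ∷_)) (words m) + countB (λ e → leadingNonzero e ∧ admissible e) (words (suc m))
        ≡⟨ cong₂ _+_ (countB-cong admissible-0∷ (words m))
                     (countB-cong (λ e → sym (valid≡leadingNonzero∧admissible e)) (words (suc m))) ⟩
      #adm m + #valid (suc m)
        ≡⟨ cong (_+ #valid (suc m)) (#adm≡1+∑#valid m) ⟩
      suc (sum (map #valid (upTo (suc m))) + #valid (suc m))
        ≡⟨ cong suc (sum-map-upTo-suc #valid (suc m)) ⟨
      suc (sum (map #valid (upTo (suc (suc m))))) ∎
      where open ≡-Reasoning

    rank≡countBelow : ∀ d → Valid d → rank d ≡ countBelow d
    rank≡countBelow (suc x ∷ d′) _ = begin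
      suc (countB P (concatMap words (upTo (suc n))))
        ≡⟨ cong suc (countB-concatMap P words (upTo (suc n))) ⟩
      suc (sum (map (countB P ∘ words) (upTo (suc n))))
        ≡⟨ cong suc (sum-map-upTo-suc (countB P ∘ words) n) ⟩
      suc (sum (map (countB P ∘ words) (upTo n)) + countB P (words n))
        ≡⟨ cong (λ s → suc (s + countB P (words n))) (sum-map-upTo-cong n shorter) ⟩
      suc (sum (map #valid (upTo n))) + countB P (words n)
        ≡⟨ cong₂ _+_ (sym (#adm≡1+∑#valid m)) sameLength ⟩
      #adm m + countB (λ e → leadingNonzero e ∧ Q e) (words n)
        ≡⟨ cong (_+ countB (λ e → leadingNonzero e ∧ Q e) (words n))
                (countB-cong (λ f → sym (trans (∧-identityʳ _) (admissible-0∷ f))) (words m)) ⟩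
      countB (Q ∘ (0 ∷_)) (words m) + countB (λ e → leadingNonzero e ∧ Q e) (words n)
        ≡⟨ countB-words-suc-leading Q m ⟨
      countBelow d ∎
      where
      open ≡-Reasoning
      d = suc x ∷ d′
      m = length d′
      n = suc m
      P Q : List ℕ → Bool
      P e = valid e ∧ precedes e d
      Q e = admissible e ∧ lexLt e d
      shorter : ∀ L → L < n → countB P (words L) ≡ #valid L
      shorter L L<n = countB-words-cong L λ e e≡L →
        trans (cong (λ l → valid e ∧ ((l <ᵇ n) ∨ ((l ≡ᵇ n) ∧ lexLt e d))) e≡L)
              (trans (cong (λ b → valid e ∧ (b ∨ ((L ≡ᵇ n) ∧ lexLt e d))) (<⇒<ᵇ≡true L<n)) (∧-identityʳ (valid e)))
      sameLength : countB P (words n) ≡ countB (λ e → leadingNonzero e ∧ Q e) (words n)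
      sameLength = countB-words-cong n λ e e≡n →
        trans (cong (λ l → valid e ∧ ((l <ᵇ n) ∨ ((l ≡ᵇ n) ∧ lexLt e d))) e≡n)
        (trans (cong₂ (λ b c → valid e ∧ (b ∨ (c ∧ lexLt e d))) (≤⇒<ᵇ≡false (≤-refl {n})) (≡ᵇ-refl n))
        (trans (cong (_∧ lexLt e d) (valid≡leadingNonzero∧admissible e)) (∧-assoc (leadingNonzero e) _ _)))

    valid-∷zeros : ∀ {d} → 0 < d → d < Λ → ∀ n → Valid (d ∷ zeros n)
    valid-∷zeros {suc d} _ d<Λ n = ≡true⇒T (trans (admissible-∷ (suc d) (zeros n))
      (trans (cong₂ (λ b c → b ∧ (c ∧ fits 0 (zeros n))) (<⇒<ᵇ≡true d<Λ) (admissible-zeros n)) (fits-zeros 0 n)))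

    module DigitOne (1<Λ : 1 < Λ) where

      valid-1∷zeros : ∀ n → Valid (1 ∷ zeros n)
      valid-1∷zeros = valid-∷zeros (s≤s z≤n) 1<Λ

      rank-1∷zeros : ∀ n → rank (1 ∷ zeros n) ≡ #adm n
      rank-1∷zeros n = begin
        rank (1 ∷ zeros n)
          ≡⟨ rank≡countBelow (1 ∷ zeros n) (valid-1∷zeros n) ⟩
        countBelow (1 ∷ zeros n)
          ≡⟨ countB-lexLt-∷ admissible 1 (zeros n) (length (zeros n)) 1<Λ ⟩
        (countB (admissible ∘ (0 ∷_)) W + 0) + countB (λ f → admissible (1 ∷ f) ∧ lexLt f (zeros n)) W
          ≡⟨ cong₂ _+_ (trans (+-identityʳ _) (countB-cong admissible-0∷ W))
                       (trans (countB-cong (λ f → trans (cong (admissible (1 ∷ f) ∧_) (lexLt-zeros f n)) (∧-zeroʳ _)) W)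
                              (countB-false W)) ⟩
        #adm (length (zeros n)) + 0
          ≡⟨ trans (+-identityʳ _) (cong #adm (length-replicate n)) ⟩
        #adm n ∎
        where
        open ≡-Reasoning
        W = words (length (zeros n))

      value-1∷zeros : ∀ c n → value c (1 ∷ zeros n) ≡ c n
      value-1∷zeros c n = begin
        (c (length (zeros n)) + 0) + value c (zeros n) ≡⟨ cong₂ _+_ (+-identityʳ _) (value-zeros n) ⟩
        c (length (zeros n)) + 0                       ≡⟨ +-identityʳ _ ⟩
        c (length (zeros n))                           ≡⟨ cong c (length-replicate n) ⟩
        c n                                            ∎
        where
        open ≡-Reasoning
        value-zeros : ∀ n → value c (zeros n) ≡ 0
        value-zeros zero    = refl
        value-zeros (suc n) = value-zeros n

      placeValues≡#adm : ∀ {c} → IsPlaceValues c → ∀ i → c i ≡ #adm i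
      placeValues≡#adm {c} (_ , _ , value≡rank) i =
        trans (sym (value-1∷zeros c i)) (trans (value≡rank _ (valid-1∷zeros i)) (rank-1∷zeros i))

      module _ (#adm≡a : ∀ n → #adm n ≡ a n) where

        a-isPlaceValues : (∀ n → a n < a (suc n)) →
                          (∀ e → admissible e ≡ true → countBelow e ≡ value #adm e) → IsPlaceValues a
        a-isPlaceValues a-increasing countBelow≡value = IsPlaceValues-cong #adm≡a
          ( refl
          , (λ n → subst₂ _<_ (sym (#adm≡a n)) (sym (#adm≡a (suc n))) (a-increasing n))
          , λ d v → sym (trans (rank≡countBelow d v) (countBelow≡value d (Valid⇒admissible d v))))

        placeValues≡a : ∀ c → IsPlaceValues c → ∀ i → c i ≡ a i
        placeValues≡a c c-placeValues i = trans (placeValues≡#adm c-placeValues i) (#adm≡a i)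

module OrderOne (lam : ℕ → ℕ) (2≤lam1 : 2 ≤ lam 1) where
  open Admissibility lam 1
  open Nondegenerate ≤-refl (<⇒≤ 2≤lam1)
  open DigitOne 2≤lam1

  μ-digit : ∀ {ℓ} → ℓ < Λ → μ ℓ ≡ 1
  μ-digit ℓ<Λ = ≤-antisym (μ-≤ ≤-refl ℓ<Λ) (μ-≥ (s≤s z≤n) (λ { zero _ → z≤n ; (suc _) (s≤s ()) }))

  fits-allLtΛ : ∀ o f → allLtΛ f ≡ true → fits o f ≡ true
  fits-allLtΛ o []      _    = refl
  fits-allLtΛ o (y ∷ f) y∷f<Λ
    rewrite μ-digit (<ᵇ⇒< y Λ (≡true⇒T (∧-conicalˡ (y <ᵇ Λ) _ y∷f<Λ))) =
    fits-allLtΛ (suc o) f (∧-conicalʳ (y <ᵇ Λ) _ y∷f<Λ)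

  admissible-∷-digit : ∀ {x} → x < Λ → ∀ f → admissible (x ∷ f) ≡ admissible f
  admissible-∷-digit {x} x<Λ f = begin
    admissible (x ∷ f)        ≡⟨ admissible-∷ x f ⟩
    (x <ᵇ Λ) ∧ tail-ok        ≡⟨ cong (_∧ tail-ok) (<⇒<ᵇ≡true x<Λ) ⟩
    tail-ok                   ≡⟨ ∧-implied no-demand ⟩
    admissible f              ∎
    where
    open ≡-Reasoning
    tail-ok : Bool
    tail-ok = admissible f ∧ ((x ≡ᵇ 0) ∨ fits 0 f)
    no-demand : admissible f ≡ true → ((x ≡ᵇ 0) ∨ fits 0 f) ≡ true
    no-demand adm = trans (cong ((x ≡ᵇ 0) ∨_) (fits-allLtΛ 0 f (∧-conicalˡ (allLtΛ f) _ adm))) (∨-zeroʳ _)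

  sum-#adm-below : ∀ y n → y ≤ Λ → sum (map (λ x → countB (admissible ∘ (x ∷_)) (words n)) (upTo y)) ≡ y * #adm n
  sum-#adm-below y n y≤Λ = trans
    (sum-map-upTo-cong y (λ x x<y → countB-cong (admissible-∷-digit (<-≤-trans x<y y≤Λ)) (words n)))
    (sum-map-upTo-const (#adm n) y)

  #adm≡a : ∀ n → #adm n ≡ a n
  #adm≡a zero    = refl
  #adm≡a (suc n) = begin
    #adm (suc n)                                                       ≡⟨ countB-words-suc admissible n ⟩
    sum (map (λ x → countB (admissible ∘ (x ∷_)) (words n)) (upTo Λ))   ≡⟨ sum-#adm-below Λ n ≤-refl ⟩
    lam 1 * #adm n                                                     ≡⟨ cong (lam 1 *_) (#adm≡a n) ⟩
    lam 1 * a n                                                        ∎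
    where open ≡-Reasoning

  a-increasing : ∀ n → a n < a (suc n)
  a-increasing n = subst (_< lam 1 * a n) (*-identityˡ (a n)) (*-monoˡ-< (a n) {{>-nonZero (a-positive n)}} 2≤lam1)
    where
    a-positive : ∀ n → 0 < a n
    a-positive zero    = s≤s z≤n
    a-positive (suc n) = *-mono-< (<⇒≤ 2≤lam1) (a-positive n)

  countBelow≡value : ∀ e → admissible e ≡ true → countBelow e ≡ value #adm e
  countBelow≡value []      _   = refl
  countBelow≡value (y ∷ e) adm = begin
    countBelow (y ∷ e)
      ≡⟨ countB-lexLt-∷ admissible y e (length e) y<Λ ⟩
    sum (map (λ x → countB (admissible ∘ (x ∷_)) (words (length e))) (upTo y))
      + countB (λ f → admissible (y ∷ f) ∧ lexLt f e) (words (length e))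
      ≡⟨ cong₂ _+_ (sum-#adm-below y (length e) (<⇒≤ y<Λ))
                   (countB-cong (λ f → cong (_∧ lexLt f e) (admissible-∷-digit y<Λ f)) (words (length e))) ⟩
    y * #adm (length e) + countBelow e
      ≡⟨ cong (y * #adm (length e) +_) (countBelow≡value e (trans (sym (admissible-∷-digit y<Λ e)) adm)) ⟩
    value #adm (y ∷ e) ∎
    where
    open ≡-Reasoning
    y<Λ : y < Λ
    y<Λ = <ᵇ⇒< y Λ (≡true⇒T (∧-conicalˡ (y <ᵇ Λ) _ (∧-conicalˡ (allLtΛ (y ∷ e)) _ adm)))

  isPlaceValueSystem : IsPlaceValueSystem
  isPlaceValueSystem = a , a-isPlaceValues #adm≡a a-increasing countBelow≡value

  placeValues-unique : ∀ c → IsPlaceValues c → ∀ i → c i ≡ a i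
  placeValues-unique = placeValues≡a #adm≡a

module TwoDigits (lam : ℕ → ℕ) (j : ℕ) (1≤lam1 : 1 ≤ lam 1) (1≤lamk : 1 ≤ lam (suc (suc j)))
                 (Λ≡2 : Zeck.Λ lam (suc (suc j)) ≡ 2) where

  κ : ℕ
  κ = suc j

  open Admissibility lam (suc κ)
  open Nondegenerate (s≤s z≤n) 1≤lam1

  1<Λ : 1 < Λ
  1<Λ = subst (1 <_) (sym Λ≡2) ≤-refl

  open DigitOne 1<Λ

  Λjκ≤1 : Λj κ ≤ 1
  Λjκ≤1 = ≤-pred (subst (_≤ 2) (+-comm (Λj κ) 1) (subst (Λj κ + 1 ≤_) Λ≡2 (+-monoʳ-≤ (Λj κ) 1≤lamk)))

  Λj≡1 : ∀ {i} → 1 ≤ i → i ≤ κ → Λj i ≡ 1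
  Λj≡1 1≤i i≤κ = ≤-antisym (≤-trans (sumTo-mono lam i≤κ) Λjκ≤1) (≤-trans 1≤lam1 (sumTo-mono lam 1≤i))

  lam1≡1 : lam 1 ≡ 1
  lam1≡1 = Λj≡1 ≤-refl (s≤s z≤n)

  lam-inner≡0 : ∀ {i} → 1 ≤ i → suc i ≤ κ → lam (suc i) ≡ 0
  lam-inner≡0 {i} 1≤i 1+i≤κ = +-cancelˡ-≡ 1 _ _ (begin
    1 + lam (suc i)      ≡⟨ cong (_+ lam (suc i)) (Λj≡1 1≤i (<⇒≤ 1+i≤κ)) ⟨
    Λj (suc i)           ≡⟨ Λj≡1 (s≤s z≤n) 1+i≤κ ⟩
    1                    ∎)
    where open ≡-Reasoning

  lamk≡1 : lam (suc κ) ≡ 1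
  lamk≡1 = +-cancelˡ-≡ 1 _ _ (trans (cong (_+ lam (suc κ)) (sym (Λj≡1 (s≤s z≤n) ≤-refl))) Λ≡2)

  μ1≡k : μ 1 ≡ suc κ
  μ1≡k = ≤-antisym (μ-≤ ≤-refl 1<Λ) (μ-≥ (n≤1+n (suc κ)) below)
    where
    below : ∀ i → i < suc κ → Λj i ≤ 1
    below zero    _       = z≤n
    below (suc i) 1+i≤1+κ = ≤-reflexive (Λj≡1 (s≤s z≤n) (≤-pred 1+i≤1+κ))

  fits-1∷ : ∀ o f → fits o (1 ∷ f) ≡ (κ ≤ᵇ o) ∧ fits (suc o) f
  fits-1∷ o f rewrite μ1≡k = refl

  μ∸1≤κ : ∀ {y} → y < 2 → μ y ∸ 1 ≤ κ
  μ∸1≤κ (s≤s z≤n)       rewrite μ0≡1 = z≤n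
  μ∸1≤κ (s≤s (s≤s z≤n)) rewrite μ1≡k = ≤-refl

  fits-≥κ : ∀ o f → κ ≤ o → allLtΛ f ≡ true → fits o f ≡ true
  fits-≥κ o []      _   _     = refl
  fits-≥κ o (y ∷ f) κ≤o y∷f<Λ = cong₂ _∧_
    (≤⇒≤ᵇ≡true (≤-trans (μ∸1≤κ y<2) κ≤o))
    (fits-≥κ (suc o) f (m≤n⇒m≤1+n κ≤o) (∧-conicalʳ (y <ᵇ Λ) _ y∷f<Λ))
    where
    y<2 : y < 2
    y<2 = <ᵇ⇒< y 2 (≡true⇒T (subst (λ m → (y <ᵇ m) ≡ true) Λ≡2 (∧-conicalˡ (y <ᵇ Λ) _ y∷f<Λ)))

  fits∧admissible-≥κ : ∀ {o} → κ ≤ o → ∀ f → fits o f ∧ admissible f ≡ admissible f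
  fits∧admissible-≥κ {o} κ≤o f =
    trans (∧-comm (fits o f) _) (∧-implied (λ adm → fits-≥κ o f κ≤o (∧-conicalˡ (allLtΛ f) _ adm)))

  admissible-1∷ : ∀ f → admissible (1 ∷ f) ≡ admissible f ∧ fits 0 f
  admissible-1∷ f = trans (admissible-∷ 1 f) (cong (_∧ (admissible f ∧ fits 0 f)) (<⇒<ᵇ≡true 1<Λ))

  admissible-2+∷ : ∀ y f → admissible (suc (suc y) ∷ f) ≡ false
  admissible-2+∷ y f = trans (admissible-∷ (suc (suc y)) f)
    (cong (_∧ (admissible f ∧ fits 0 f)) (≤⇒<ᵇ≡false (subst (_≤ suc (suc y)) (sym Λ≡2) (s≤s (s≤s z≤n)))))

  countB-words-suc-binary : ∀ p n →
    countB p (words (suc n)) ≡ countB (p ∘ (0 ∷_)) (words n) + countB (p ∘ (1 ∷_)) (words n)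
  countB-words-suc-binary p n = trans (countB-words-suc p n)
    (trans (cong (λ m → sum (map (λ x → countB (p ∘ (x ∷_)) (words n)) (upTo m))) Λ≡2)
           (cong (countB (p ∘ (0 ∷_)) (words n) +_) (+-identityʳ _)))

  -- #fits o n counts the admissible f of length n for which 1 0ᵒ f is admissible.
  #fits : ℕ → ℕ → ℕ
  #fits o n = countB (λ f → fits o f ∧ admissible f) (words n)

  #fits-≥κ : ∀ {o} → κ ≤ o → ∀ n → #fits o n ≡ #adm n
  #fits-≥κ κ≤o n = countB-cong (fits∧admissible-≥κ κ≤o) (words n)

  #fits-suc : ∀ {o} → o < κ → ∀ n → #fits o (suc n) ≡ #fits (suc o) n
  #fits-suc {o} o<κ n = trans (countB-words-suc-binary (λ f → fits o f ∧ admissible f) n)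
    (trans (cong₂ _+_ (countB-cong (λ f → cong₂ _∧_ (fits-0∷ o f) (admissible-0∷ f)) (words n)) no-leading-1)
           (+-identityʳ _))
    where
    no-leading-1 : countB (λ f → fits o (1 ∷ f) ∧ admissible (1 ∷ f)) (words n) ≡ 0
    no-leading-1 = trans (countB-cong (λ f → cong (_∧ admissible (1 ∷ f)) (1∷f-unfit f)) (words n)) (countB-false (words n))
      where
      1∷f-unfit : ∀ f → fits o (1 ∷ f) ≡ false
      1∷f-unfit f = trans (fits-1∷ o f) (cong (_∧ fits (suc o) f) (<⇒≤ᵇ≡false o<κ))

  #adm-suc : ∀ n → #adm (suc n) ≡ #adm n + #fits 0 n
  #adm-suc n = trans (countB-words-suc-binary admissible n) (cong₂ _+_
    (countB-cong admissible-0∷ (words n))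
    (countB-cong (λ f → trans (admissible-1∷ f) (∧-comm (admissible f) (fits 0 f))) (words n)))

  a-suc : ∀ n → a (suc n) ≡ a n + lookupD 1 (aHist n) κ
  a-suc n = cong₂ _+_ (sumTo-inner κ (s≤s z≤n) ≤-refl) (trans (cong (_* L κ) lamk≡1) (+-identityʳ (L κ)))
    where
    L : ℕ → ℕ
    L = lookupD 1 (aHist n)
    sumTo-inner : ∀ t → 1 ≤ t → t ≤ κ → sumTo t (λ i → lam i * L (i ∸ 1)) ≡ L 0
    sumTo-inner (suc zero)    _ _       = trans (cong (_* L 0) lam1≡1) (+-identityʳ (L 0))
    sumTo-inner (suc (suc t)) _ 2+t≤κ   = trans
      (cong₂ _+_ (sumTo-inner (suc t) (s≤s z≤n) (<⇒≤ 2+t≤κ)) (cong (_* L (suc t)) (lam-inner≡0 (s≤s z≤n) 2+t≤κ)))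
      (+-identityʳ (L 0))

  -- lookupD 1 (aHist n) d is a_{n-d}.
  #fits≡lookup : ∀ n d → d ≤ κ → #fits (κ ∸ d) n ≡ lookupD 1 (aHist n) d
  #fits≡lookup zero    zero    _ = refl
  #fits≡lookup zero    (suc d) _ = refl
  #fits≡lookup (suc n) zero    _ = begin
    #fits κ (suc n)          ≡⟨ #fits-≥κ ≤-refl (suc n) ⟩
    #adm (suc n)             ≡⟨ #adm-suc n ⟩
    #adm n + #fits 0 n       ≡⟨ cong₂ _+_ (trans (sym (#fits-≥κ ≤-refl n)) (#fits≡lookup n 0 z≤n))
                                          (trans (cong (λ o → #fits o n) (sym (n∸n≡0 κ))) (#fits≡lookup n κ ≤-refl)) ⟩
    a n + lookupD 1 (aHist n) κ ≡⟨ a-suc n ⟨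
    a (suc n)                ∎
    where open ≡-Reasoning
  #fits≡lookup (suc n) (suc d) 1+d≤κ = begin
    #fits (j ∸ d) (suc n)    ≡⟨ #fits-suc (s≤s (m∸n≤m j d)) n ⟩
    #fits (suc (j ∸ d)) n    ≡⟨ cong (λ o → #fits o n) (+-∸-assoc 1 (≤-pred 1+d≤κ)) ⟨
    #fits (κ ∸ d) n          ≡⟨ #fits≡lookup n d (<⇒≤ 1+d≤κ) ⟩
    lookupD 1 (aHist n) d    ∎
    where open ≡-Reasoning

  #adm≡a : ∀ n → #adm n ≡ a n
  #adm≡a n = trans (sym (#fits-≥κ ≤-refl n)) (#fits≡lookup n 0 z≤n)

  a-increasing : ∀ n → a n < a (suc n)
  a-increasing n = subst (a n <_) (sym (a-suc n)) (m<m+n (a n) (lookup-positive n κ))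
    where
    lookup-positive : ∀ n d → 0 < lookupD 1 (aHist n) d
    lookup-positive zero    zero    = ≤-refl
    lookup-positive zero    (suc d) = ≤-refl
    lookup-positive (suc n) zero    = subst (0 <_) (sym (a-suc n)) (≤-trans (lookup-positive n κ) (m≤n+m _ (a n)))
    lookup-positive (suc n) (suc d) = lookup-positive n d

  countBelow-fits : ∀ e o → admissible e ≡ true → fits o e ≡ true →
    countB (λ f → (fits o f ∧ admissible f) ∧ lexLt f e) (words (length e)) ≡ value #adm e
  countBelow-fits []      _ _   _        = refl
  countBelow-fits (0 ∷ e) o adm fits-0∷e = begin
    countB (λ f → (fits o f ∧ admissible f) ∧ lexLt f (0 ∷ e)) (words (suc n))
      ≡⟨ countB-lexLt-∷ (λ f → fits o f ∧ admissible f) 0 e n (<-trans (s≤s z≤n) 1<Λ) ⟩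
    countB (λ f → (fits o (0 ∷ f) ∧ admissible (0 ∷ f)) ∧ lexLt f e) (words n)
      ≡⟨ countB-cong (λ f → cong (_∧ lexLt f e) (cong₂ _∧_ (fits-0∷ o f) (admissible-0∷ f))) (words n) ⟩
    countB (λ f → (fits (suc o) f ∧ admissible f) ∧ lexLt f e) (words n)
      ≡⟨ countBelow-fits e (suc o) (trans (sym (admissible-0∷ e)) adm) (trans (sym (fits-0∷ o e)) fits-0∷e) ⟩
    value #adm e ∎
    where
    open ≡-Reasoning
    n = length e
  countBelow-fits (1 ∷ e) o adm fits-1∷e = begin
    countB (λ f → (fits o f ∧ admissible f) ∧ lexLt f (1 ∷ e)) (words (suc n))
      ≡⟨ countB-lexLt-∷ (λ f → fits o f ∧ admissible f) 1 e n 1<Λ ⟩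
    (countB (λ f → fits o (0 ∷ f) ∧ admissible (0 ∷ f)) (words n) + 0)
      + countB (λ f → (fits o (1 ∷ f) ∧ admissible (1 ∷ f)) ∧ lexLt f e) (words n)
      ≡⟨ cong₂ _+_ (cong (_+ 0) leading-0) (countB-cong (λ f → cong (_∧ lexLt f e) (leading-1 f)) (words n)) ⟩
    (#adm n + 0) + countB (λ f → (fits 0 f ∧ admissible f) ∧ lexLt f e) (words n)
      ≡⟨ cong ((#adm n + 0) +_) (countBelow-fits e 0 (∧-conicalˡ (admissible e) _ adm-e∧fits-e)
                                                     (∧-conicalʳ (admissible e) _ adm-e∧fits-e)) ⟩
    value #adm (1 ∷ e) ∎
    where
    open ≡-Reasoning
    n = length e
    κ≤o : κ ≤ o
    κ≤o = ≤ᵇ⇒≤ κ o (≡true⇒T (∧-conicalˡ (κ ≤ᵇ o) _ (trans (sym (fits-1∷ o e)) fits-1∷e)))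
    adm-e∧fits-e : admissible e ∧ fits 0 e ≡ true
    adm-e∧fits-e = trans (sym (admissible-1∷ e)) adm
    leading-0 : countB (λ f → fits o (0 ∷ f) ∧ admissible (0 ∷ f)) (words n) ≡ #adm n
    leading-0 = trans (countB-cong (λ f → cong₂ _∧_ (fits-0∷ o f) (admissible-0∷ f)) (words n))
                      (#fits-≥κ (m≤n⇒m≤1+n κ≤o) n)
    leading-1 : ∀ f → fits o (1 ∷ f) ∧ admissible (1 ∷ f) ≡ fits 0 f ∧ admissible f
    leading-1 f rewrite fits-1∷ o f | ≤⇒≤ᵇ≡true κ≤o | admissible-1∷ f with fits 0 f in fits-0
    ... | true  = trans (cong (_∧ (admissible f ∧ true)) (fits-mono f z≤n fits-0)) (∧-identityʳ (admissible f))
    ... | false = trans (cong (fits (suc o) f ∧_) (∧-zeroʳ (admissible f))) (∧-zeroʳ (fits (suc o) f))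
  countBelow-fits (suc (suc y) ∷ e) _ adm _ with () ← trans (sym adm) (admissible-2+∷ y e)

  countBelow≡value : ∀ e → admissible e ≡ true → countBelow e ≡ value #adm e
  countBelow≡value e adm = trans
    (countB-cong (λ f → cong (_∧ lexLt f e) (sym (fits∧admissible-≥κ ≤-refl f))) (words (length e)))
    (countBelow-fits e κ adm (fits-≥κ κ e ≤-refl (∧-conicalˡ (allLtΛ e) _ adm)))

  isPlaceValueSystem : IsPlaceValueSystem
  isPlaceValueSystem = a , a-isPlaceValues #adm≡a a-increasing countBelow≡value

  placeValues-unique : ∀ c → IsPlaceValues c → ∀ i → c i ≡ a i
  placeValues-unique = placeValues≡a #adm≡a

lam1+lamk≤Λ : ∀ lam j → lam 1 + lam (suc (suc j)) ≤ Zeck.Λ lam (suc (suc j))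
lam1+lamk≤Λ lam j = +-monoˡ-≤ (lam (suc (suc j))) (sumTo-mono lam (s≤s z≤n))

module ManyDigits (lam : ℕ → ℕ) (j : ℕ) (1≤lam1 : 1 ≤ lam 1) (1≤lamk : 1 ≤ lam (suc (suc j)))
                  (3≤Λ : 3 ≤ Zeck.Λ lam (suc (suc j))) where

  open Admissibility lam (suc (suc j))
  open Nondegenerate (s≤s z≤n) 1≤lam1
  open DigitOne (≤-trans (s≤s (s≤s z≤n)) 3≤Λ)

  lam1<Λ : lam 1 < Λ
  lam1<Λ = ≤-trans (subst (_≤ lam 1 + lam (suc (suc j))) (+-comm (lam 1) 1) (+-monoʳ-≤ (lam 1) 1≤lamk))
                   (lam1+lamk≤Λ lam j)

  admissible-lam1 : admissible (lam 1 ∷ []) ≡ true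
  admissible-lam1 = cong (λ b → (b ∧ true) ∧ true) (<⇒<ᵇ≡true lam1<Λ)

  admissible-1∷lam1 : admissible (1 ∷ lam 1 ∷ []) ≡ false
  admissible-1∷lam1 = trans (admissible-∷ 1 (lam 1 ∷ []))
    (trans (cong (λ b → (1 <ᵇ Λ) ∧ (admissible (lam 1 ∷ []) ∧ (b ∧ true))) (<⇒≤ᵇ≡false (m<n⇒0<n∸m 1<μ)))
           (trans (cong ((1 <ᵇ Λ) ∧_) (∧-zeroʳ _)) (∧-zeroʳ _)))
    where
    1<μ : 1 < μ (lam 1)
    1<μ = μ-≥ (s≤s (s≤s z≤n)) (λ { zero _ → z≤n ; (suc zero) _ → ≤-refl ; (suc (suc _)) (s≤s (s≤s ())) })

  #adm-after-1 : ℕ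
  #adm-after-1 = countB (admissible ∘ (1 ∷_)) (words 1)

  #adm-after-1<#adm : #adm-after-1 < #adm 1
  #adm-after-1<#adm = subst₂ _<_ (sym (countB-words-suc (admissible ∘ (1 ∷_)) 0)) (sym (countB-words-suc admissible 0))
    (sum-map-upTo-strict (λ x → countB-mono (admissible-∷⇒admissible 1 ∘ (x ∷_)) (words 0)) Λ lam1<Λ
      (subst₂ (λ b c → (if b then 1 else 0) + 0 < (if c then 1 else 0) + 0)
              (sym admissible-1∷lam1) (sym admissible-lam1) ≤-refl))

  valid-2∷0 : Valid (2 ∷ 0 ∷ [])
  valid-2∷0 = valid-∷zeros (s≤s z≤n) 3≤Λ 1

  rank-2∷0 : rank (2 ∷ 0 ∷ []) ≡ #adm 1 + #adm-after-1
  rank-2∷0 = begin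
    rank (2 ∷ 0 ∷ [])
      ≡⟨ rank≡countBelow (2 ∷ 0 ∷ []) valid-2∷0 ⟩
    countBelow (2 ∷ 0 ∷ [])
      ≡⟨ countB-lexLt-∷ admissible 2 (0 ∷ []) 1 3≤Λ ⟩
    (countB (admissible ∘ (0 ∷_)) (words 1) + (#adm-after-1 + 0))
      + countB (λ f → admissible (2 ∷ f) ∧ lexLt f (0 ∷ [])) (words 1)
      ≡⟨ cong₂ _+_ (cong₂ _+_ (countB-cong admissible-0∷ (words 1)) (+-identityʳ _))
                   (trans (countB-cong (λ f → trans (cong (admissible (2 ∷ f) ∧_) (lexLt-zeros f 1)) (∧-zeroʳ _)) (words 1))
                          (countB-false (words 1))) ⟩
    (#adm 1 + #adm-after-1) + 0
      ≡⟨ +-identityʳ _ ⟩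
    #adm 1 + #adm-after-1 ∎
    where open ≡-Reasoning

  ¬isPlaceValueSystem : ¬ IsPlaceValueSystem
  ¬isPlaceValueSystem (c , c-placeValues@(_ , _ , value≡rank)) =
    <-irrefl (+-cancelˡ-≡ (#adm 1) _ _ (sym doubled)) #adm-after-1<#adm
    where
    open ≡-Reasoning
    doubled : #adm 1 + #adm 1 ≡ #adm 1 + #adm-after-1
    doubled = begin
      #adm 1 + #adm 1           ≡⟨ cong (λ x → x + x) (placeValues≡#adm c-placeValues 1) ⟨
      c 1 + c 1                 ≡⟨ trans (+-identityʳ _) (cong (c 1 +_) (+-identityʳ (c 1))) ⟨
      value c (2 ∷ 0 ∷ [])      ≡⟨ value≡rank (2 ∷ 0 ∷ []) valid-2∷0 ⟩
      rank (2 ∷ 0 ∷ [])         ≡⟨ rank-2∷0 ⟩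
      #adm 1 + #adm-after-1     ∎

proposition4p6 : (lam : ℕ → ℕ) (k : ℕ) → 1 ≤ k → 1 ≤ lam 1 → 1 ≤ lam k
    → (∀ i → k < i → lam i ≡ 0) → (k ≡ 1 → 2 ≤ lam 1)
    → (Zeck.IsPlaceValueSystem lam k ⇔ (k ≡ 1 ⊎ (1 < k × Zeck.Λ lam k ≡ 2)))
      × (∀ c → Zeck.IsPlaceValues lam k c → ∀ i → c i ≡ Zeck.a lam k i)
proposition4p6 lam zero () _ _ _ _
proposition4p6 lam 1 _ _ _ _ 2≤lam1 =
  mk⇔ (const (inj₁ refl)) (const isPlaceValueSystem) , placeValues-unique
  where open OrderOne lam (2≤lam1 refl)
proposition4p6 lam (suc (suc j)) _ 1≤lam1 1≤lamk _ _ with Zeck.Λ lam (suc (suc j)) ≟ 2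
... | yes Λ≡2 = mk⇔ (const (inj₂ (s≤s (s≤s z≤n) , Λ≡2))) (const isPlaceValueSystem) , placeValues-unique
  where open TwoDigits lam j 1≤lam1 1≤lamk Λ≡2
... | no Λ≢2 =
  mk⇔ (⊥-elim ∘ ¬isPlaceValueSystem) (λ { (inj₁ ()) ; (inj₂ (_ , Λ≡2)) → ⊥-elim (Λ≢2 Λ≡2) })
  , λ c c-placeValues → ⊥-elim (¬isPlaceValueSystem (c , c-placeValues))
  where
  2≤Λ : 2 ≤ Zeck.Λ lam (suc (suc j))
  2≤Λ = ≤-trans (+-mono-≤ 1≤lam1 1≤lamk) (lam1+lamk≤Λ lam j)
  open ManyDigits lam j 1≤lam1 1≤lamk (≤∧≢⇒< 2≤Λ (Λ≢2 ∘ sym))
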